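{- Let $G$ be a graph and fix a vertex $P\in V(G)$. For every $n,k\in\mathbb{N}$, \[\big|H_r(P)\cap[1,nk]\big|\ge k\,\big|H_r(P)\cap[1,n]\big|.\]
   Context: A graph is a finite connected multigraph with no loop edges. $\mathbb{N}=\{0,1,2,\dots\}$; $[a,b]$ denotes the set of integers between $a$ and $b$ inclusive. A divisor on $G$ is a formal integer combination $D=\sum_{Q\in V(G)}D(Q)\,Q$; $\deg D=\sum_Q D(Q)$; effective means all coefficients $\ge0$. For $f:V(G)\to\mathbb{Z}$, $\Delta f(Q)=\sum_{e=QR\in E(G)}(f(Q)-f(R))$. $|D|=\{E\ge 0:E-D=\Delta f\text{ for some }f\}$. The rank $r(D)$ is $-1$ if $|D|=\emptyset$, and otherwise the largest $k\ge 0$ such that $|D-E|\neq\emptyset$ for every effective divisor $E$ of degree $k$. $H_r(P)=\{m\in\mathbb{N}: r(mP)>r((m-1)P)\}$. -}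

module Defs where

open import Data.Nat as ℕ using (ℕ; zero; suc)
open import Data.Integer as ℤ using (ℤ; +_; _-_; _*_; _+_; _≤_; _<_; -1ℤ)
open import Data.Fin as Fin using (Fin)
open import Data.Bool using (Bool; true; false; if_then_else_)
open import Data.Product using (Σ; ∃; _×_; _,_)
open import Relation.Nullary using (¬_; does)
open import Relation.Binary.PropositionalEquality using (_≡_)

sumFin : ∀ {n} → (Fin n → ℤ) → ℤ
sumFin {zero}  f = + 0
sumFin {suc n} f = f Fin.zero + sumFin (λ i → f (Fin.suc i))

data Reachable {n : ℕ} (mult : Fin n → Fin n → ℕ) : Fin n → Fin n → Set where
  here : ∀ {i} → Reachable mult i i
  step : ∀ {i j k} → 1 ℕ.≤ mult i j → Reachable mult j k → Reachable mult i k

record Graph : Set where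
  field
    size      : ℕ
    mult      : Fin size → Fin size → ℕ
    symmetric : ∀ i j → mult i j ≡ mult j i
    loopless  : ∀ i → mult i i ≡ 0
    connected : ∀ i j → Reachable mult i j

open Graph public

Divisor : Graph → Set
Divisor G = Fin (size G) → ℤ

deg : (G : Graph) → Divisor G → ℤ
deg G D = sumFin D

Effective : (G : Graph) → Divisor G → Set
Effective G D = ∀ Q → + 0 ≤ D Q

Δ : (G : Graph) → (Fin (size G) → ℤ) → Divisor G
Δ G f Q = sumFin (λ R → + (mult G Q R) * (f Q - f R))

divSub : (G : Graph) → Divisor G → Divisor G → Divisor G
divSub G D E Q = D Q - E Q

LinSysNonempty : (G : Graph) → Divisor G → Set
LinSysNonempty G D =
  Σ (Divisor G) λ E → Effective G E × Σ (Fin (size G) → ℤ) λ f → ∀ Q → E Q - D Q ≡ Δ G f Q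

RankAtLeast : (G : Graph) → Divisor G → ℕ → Set
RankAtLeast G D k = ∀ (E : Divisor G) → Effective G E → deg G E ≡ + k → LinSysNonempty G (divSub G D E)

IsRank : (G : Graph) → Divisor G → ℤ → Set
IsRank G D ℤ.-[1+ zero ] = ¬ LinSysNonempty G D
IsRank G D ℤ.-[1+ suc _ ] = Data.Empty.⊥
  where import Data.Empty
IsRank G D (+ k) = LinSysNonempty G D × RankAtLeast G D k × (∀ j → RankAtLeast G D j → j ℕ.≤ k)

scalePt : (G : Graph) → ℤ → Fin (size G) → Divisor G
scalePt G z P Q = if does (Q Fin.≟ P) then z else + 0

countUpTo : (ℕ → Bool) → ℕ → ℕ
countUpTo p zero = 0
countUpTo p (suc N) = countUpTo p N ℕ.+ (if p (suc N) then 1 else 0)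

-- Membership m ∈ H_r(P), computed from the rank function r:
-- r(mP) > r((m-1)P)
inH : (G : Graph) → (Divisor G → ℤ) → Fin (size G) → ℕ → Bool
inH G r P m = does (r (scalePt G (+ m - + 1) P) ℤ.<? r (scalePt G (+ m) P))

countH : (G : Graph) → (Divisor G → ℤ) → Fin (size G) → ℕ → ℕ
countH G r P N = countUpTo (inH G r P) N

-- Write ρ m for r(mP), a natural number because mP is effective. Adding P to a divisor
-- raises its rank by at most one and never lowers it, so ρ N = ρ 0 + |H_r(P) ∩ [1, N]|.
-- Rank is superadditive, r(D + D′) ≥ r(D) + r(D′) (by induction on r(D): a test divisor of
-- positive degree contains a point Q, and r(D − Q) ≥ r(D) − 1), hence ρ (k n) ≥ k ρ n, and
-- the claim follows since ρ 0 ≤ k ρ 0 for k ≥ 1.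
module Submission where

open import Defs
open import Data.Nat using (ℕ; _*_; _≤_)
open import Data.Integer using (ℤ)
open import Data.Fin using (Fin)

open import Data.Nat as ℕ using (zero; suc; z≤n; s≤s)
import Data.Nat.Properties as ℕP
open import Data.Integer as ℤ using (+_; -_; _-_; _+_; -[1+_]; +≤+; +<+)
import Data.Integer.Properties as ℤP
open import Algebra.Properties.CommutativeSemigroup ℤP.+-commutativeSemigroup
  using (interchange)
open import Data.Integer.Tactic.RingSolver using (solve-∀)
import Data.Fin as Fin
open import Data.Fin.Properties using (suc-injective)
open import Data.Bool using (Bool; true; false; if_then_else_)
open import Data.Product using (Σ; _×_; _,_; proj₁; proj₂)
open import Data.Sum using (inj₁; inj₂)
open import Data.Empty using (⊥-elim)
open import Relation.Nullary using (does; yes; no)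
open import Relation.Nullary.Decidable using (dec-true; dec-false)
open import Relation.Binary.PropositionalEquality

sumFin-cong : ∀ {n} {f g : Fin n → ℤ} → f ≗ g → sumFin f ≡ sumFin g
sumFin-cong {zero}  f≗g = refl
sumFin-cong {suc n} f≗g = cong₂ _+_ (f≗g Fin.zero) (sumFin-cong (λ i → f≗g (Fin.suc i)))

sumFin-zero : ∀ {n} {f : Fin n → ℤ} → (∀ i → f i ≡ + 0) → sumFin f ≡ + 0
sumFin-zero {zero}  f≡0 = refl
sumFin-zero {suc n} f≡0 = cong₂ _+_ (f≡0 Fin.zero) (sumFin-zero (λ i → f≡0 (Fin.suc i)))

sumFin-+ : ∀ {n} (f g : Fin n → ℤ) → sumFin (λ i → f i + g i) ≡ sumFin f + sumFin g
sumFin-+ {zero}  f g = refl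
sumFin-+ {suc n} f g = begin
  (f₀ + g₀) + sumFin (λ i → f (Fin.suc i) + g (Fin.suc i))
    ≡⟨ cong (_+_ (f₀ + g₀)) (sumFin-+ (λ i → f (Fin.suc i)) (λ i → g (Fin.suc i))) ⟩
  (f₀ + g₀) + (sumFin (λ i → f (Fin.suc i)) + sumFin (λ i → g (Fin.suc i)))
    ≡⟨ interchange f₀ g₀ _ _ ⟩
  (f₀ + sumFin (λ i → f (Fin.suc i))) + (g₀ + sumFin (λ i → g (Fin.suc i))) ∎
  where
  open ≡-Reasoning
  f₀ g₀ : ℤ
  f₀ = f Fin.zero
  g₀ = g Fin.zero

sumFin-neg : ∀ {n} (f : Fin n → ℤ) → sumFin (λ i → - f i) ≡ - sumFin f
sumFin-neg {zero}  f = refl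
sumFin-neg {suc n} f =
  trans (cong (_+_ (- f Fin.zero)) (sumFin-neg (λ i → f (Fin.suc i))))
        (sym (ℤP.neg-distrib-+ (f Fin.zero) _))

sumFin-concentrated : ∀ {n} (f : Fin n → ℤ) (P : Fin n) →
                      (∀ Q → Q ≢ P → f Q ≡ + 0) → sumFin f ≡ f P
sumFin-concentrated f Fin.zero f≡0 =
  trans (cong (_+_ (f Fin.zero)) (sumFin-zero (λ i → f≡0 (Fin.suc i) λ ())))
        (ℤP.+-identityʳ (f Fin.zero))
sumFin-concentrated f (Fin.suc P) f≡0 =
  trans (cong₂ _+_ (f≡0 Fin.zero λ ())
                   (sumFin-concentrated (λ i → f (Fin.suc i)) P
                      (λ Q Q≢P → f≡0 (Fin.suc Q) (λ eq → Q≢P (suc-injective eq)))))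
        (ℤP.+-identityˡ (f (Fin.suc P)))

sumFin-suc⇒positive : ∀ {n a} (f : Fin n → ℤ) → (∀ i → + 0 ℤ.≤ f i) →
                      sumFin f ≡ + suc a → Σ (Fin n) λ i → Σ ℕ λ x → f i ≡ + suc x
sumFin-suc⇒positive {zero} f f≥0 ()
sumFin-suc⇒positive {suc n} f f≥0 sum≡ with f Fin.zero in eq
... | + suc x  = Fin.zero , x , eq
... | -[1+ x ] with () ← subst (+ 0 ℤ.≤_) eq (f≥0 Fin.zero)
... | + zero
  with i , x , eq′ ← sumFin-suc⇒positive (λ i → f (Fin.suc i)) (λ i → f≥0 (Fin.suc i))
                            (trans (sym (ℤP.+-identityˡ _)) sum≡)
  = Fin.suc i , x , eq′

scalePt-at : ∀ G z (P : Fin (size G)) → scalePt G z P P ≡ z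
scalePt-at G z P rewrite dec-true (P Fin.≟ P) refl = refl

scalePt-off : ∀ G z {P Q : Fin (size G)} → Q ≢ P → scalePt G z P Q ≡ + 0
scalePt-off G z {P} {Q} Q≢P rewrite dec-false (Q Fin.≟ P) Q≢P = refl

scalePt-+ : ∀ G a b (P : Fin (size G)) →
            scalePt G (a + b) P ≗ λ Q → scalePt G a P Q + scalePt G b P Q
scalePt-+ G a b P Q with does (Q Fin.≟ P)
... | true  = refl
... | false = refl

scalePt-nonneg : ∀ G {z} (P : Fin (size G)) → + 0 ℤ.≤ z → Effective G (scalePt G z P)
scalePt-nonneg G P z≥0 Q with does (Q Fin.≟ P)
... | true  = z≥0
... | false = +≤+ z≤n

deg-scalePt : ∀ G z (P : Fin (size G)) → deg G (scalePt G z P) ≡ z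
deg-scalePt G z P = trans (sumFin-concentrated _ P (λ Q → scalePt-off G z)) (scalePt-at G z P)

module LinearSystems (G : Graph) where

  infixl 6 _⊕_

  _⊕_ : Divisor G → Divisor G → Divisor G
  (D ⊕ D′) Q = D Q + D′ Q

  pt : Fin (size G) → Divisor G
  pt = scalePt G (+ 1)

  Δ-+ : ∀ (f g : Fin (size G) → ℤ) → Δ G (λ v → f v + g v) ≗ Δ G f ⊕ Δ G g
  Δ-+ f g Q = trans (sumFin-cong λ R → distrib (+ mult G Q R) (f Q) (g Q) (f R) (g R))
                    (sumFin-+ (λ R → + mult G Q R ℤ.* (f Q - f R))
                              (λ R → + mult G Q R ℤ.* (g Q - g R)))
    where
    distrib : ∀ m a b c d → m ℤ.* ((a + b) - (c + d)) ≡ m ℤ.* (a - c) + m ℤ.* (b - d)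
    distrib = solve-∀

  Δ-zero : Δ G (λ _ → + 0) ≗ λ _ → + 0
  Δ-zero Q = sumFin-zero λ R → ℤP.*-zeroʳ (+ mult G Q R)

  linSys-resp : ∀ {D D′} → D ≗ D′ → LinSysNonempty G D → LinSysNonempty G D′
  linSys-resp D≗D′ (E , E≥0 , f , E-D≡Δf) =
    E , E≥0 , f , λ Q → trans (cong (_-_ (E Q)) (sym (D≗D′ Q))) (E-D≡Δf Q)

  effective⇒linSys : ∀ {D} → Effective G D → LinSysNonempty G D
  effective⇒linSys {D} D≥0 =
    D , D≥0 , (λ _ → + 0) , λ Q → trans (ℤP.+-inverseʳ (D Q)) (sym (Δ-zero Q))

  linSys-⊕ : ∀ {D D′} → LinSysNonempty G D → LinSysNonempty G D′ → LinSysNonempty G (D ⊕ D′)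
  linSys-⊕ {D} {D′} (E , E≥0 , f , E-D≡Δf) (E′ , E′≥0 , f′ , E′-D′≡Δf′) =
    E ⊕ E′ , (λ Q → ℤP.+-mono-≤ (E≥0 Q) (E′≥0 Q)) , (λ v → f v + f′ v) ,
    λ Q → begin
      (E Q + E′ Q) - (D Q + D′ Q) ≡⟨ sub-+ (E Q) (E′ Q) (D Q) (D′ Q) ⟩
      (E Q - D Q) + (E′ Q - D′ Q) ≡⟨ cong₂ _+_ (E-D≡Δf Q) (E′-D′≡Δf′ Q) ⟩
      Δ G f Q + Δ G f′ Q          ≡⟨ Δ-+ f f′ Q ⟨
      Δ G (λ v → f v + f′ v) Q    ∎
    where
    open ≡-Reasoning
    sub-+ : ∀ a b c d → (a + b) - (c + d) ≡ (a - c) + (b - d)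
    sub-+ = solve-∀

  rankAtLeast-resp : ∀ {D D′ j} → D ≗ D′ → RankAtLeast G D j → RankAtLeast G D′ j
  rankAtLeast-resp {D} D≗D′ rk E E≥0 degE =
    linSys-resp {divSub G D E} (λ Q → cong (_- E Q) (D≗D′ Q)) (rk E E≥0 degE)

  rankAtLeast-zero⇒linSys : ∀ {D} → RankAtLeast G D 0 → LinSysNonempty G D
  rankAtLeast-zero⇒linSys {D} rk =
    linSys-resp (λ Q → ℤP.+-identityʳ (D Q))
      (rk (λ _ → + 0) (λ _ → +≤+ z≤n) (sumFin-zero {size G} λ _ → refl))

  effective-minus-pt : ∀ {E} Q {x} → Effective G E → E Q ≡ + suc x →
                       Effective G (divSub G E (pt Q))
  -- Matching on Q′ ≟ Q also evaluates the conditional inside pt Q Q′.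
  effective-minus-pt {E} Q E≥0 EQ≡ Q′ with Q′ Fin.≟ Q
  ... | yes refl rewrite EQ≡ = +≤+ z≤n
  ... | no _ rewrite ℤP.+-identityʳ (E Q′) = E≥0 Q′

  -- An effective E of degree a + 1 contains some point Q, and E − Q is effective of degree a.
  rankAtLeast-suc : ∀ {D a} → (∀ Q → RankAtLeast G (divSub G D (pt Q)) a) →
                    RankAtLeast G D (suc a)
  rankAtLeast-suc {D} {a} rk E E≥0 degE
    with Q , x , EQ≡ ← sumFin-suc⇒positive E E≥0 degE =
    linSys-resp (λ Q′ → cancel (D Q′) (E Q′) (pt Q Q′))
      (rk Q (divSub G E (pt Q)) (effective-minus-pt Q E≥0 EQ≡) deg-E-Q)
    where
    cancel : ∀ d e q → (d - q) - (e - q) ≡ d - e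
    cancel = solve-∀
    deg-E-Q : deg G (divSub G E (pt Q)) ≡ + a
    deg-E-Q = trans (sumFin-+ E (λ i → - pt Q i))
                    (cong₂ _+_ degE (trans (sumFin-neg (pt Q)) (cong -_ (deg-scalePt G (+ 1) Q))))

  rankAtLeast-suc⁻¹ : ∀ {D a} → RankAtLeast G D (suc a) →
                      ∀ Q → RankAtLeast G (divSub G D (pt Q)) a
  rankAtLeast-suc⁻¹ {D} {a} rk Q E E≥0 degE =
    linSys-resp (λ Q′ → regroup (D Q′) (E Q′) (pt Q Q′))
      (rk (E ⊕ pt Q) (λ Q′ → ℤP.+-mono-≤ (E≥0 Q′) (scalePt-nonneg G Q (+≤+ z≤n) Q′))
          (trans (sumFin-+ E (pt Q)) (trans (cong₂ _+_ degE (deg-scalePt G (+ 1) Q))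
                                            (cong +_ (ℕP.+-comm a 1)))))
    where
    regroup : ∀ d e q → d - (e + q) ≡ (d - q) - e
    regroup = solve-∀

  rankAtLeast-⊕ : ∀ a {b D D′} → RankAtLeast G D a → RankAtLeast G D′ b →
                  RankAtLeast G (D ⊕ D′) (a ℕ.+ b)
  rankAtLeast-⊕ zero {D = D} {D′} rk rk′ E E≥0 degE =
    linSys-resp (λ Q → regroup (D Q) (D′ Q) (E Q))
      (linSys-⊕ {D} (rankAtLeast-zero⇒linSys {D} rk) (rk′ E E≥0 degE))
    where
    regroup : ∀ d d′ e → d + (d′ - e) ≡ (d + d′) - e
    regroup = solve-∀
  rankAtLeast-⊕ (suc a) {D = D} {D′} rk rk′ = rankAtLeast-suc {D ⊕ D′} λ Q →
    rankAtLeast-resp {divSub G D (pt Q) ⊕ D′} (λ Q′ → regroup (D Q′) (D′ Q′) (pt Q Q′))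
      (rankAtLeast-⊕ a {D = divSub G D (pt Q)} {D′} (rankAtLeast-suc⁻¹ {D} rk Q) rk′)
    where
    regroup : ∀ d d′ q → (d - q) + d′ ≡ (d + d′) - q
    regroup = solve-∀

  rankAtLeast-⊕-effective : ∀ {D F j} → RankAtLeast G D j → Effective G F →
                            RankAtLeast G (D ⊕ F) j
  rankAtLeast-⊕-effective {D} {F} rk F≥0 E E≥0 degE =
    linSys-resp (λ Q → regroup (D Q) (E Q) (F Q))
      (linSys-⊕ (rk E E≥0 degE) (effective⇒linSys F≥0))
    where
    regroup : ∀ d e f → (d - e) + f ≡ (d + f) - e
    regroup = solve-∀

jump-indicator : ∀ {a a′} → a ≤ a′ → a′ ≤ suc a →
                 (if does (+ a ℤ.<? + a′) then 1 else 0) ℕ.+ a ≡ a′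
jump-indicator {a} a≤a′ a′≤1+a with ℕP.m≤n⇒m<n∨m≡n a≤a′
... | inj₁ a<a′ with refl ← ℕP.≤-antisym a<a′ a′≤1+a
  rewrite dec-true (+ a ℤ.<? + suc a) (+<+ (ℕP.n<1+n a)) = refl
... | inj₂ refl rewrite dec-false (+ a ℤ.<? + a) (ℤP.<-irrefl refl) = refl

countUpTo-jumps : (f : ℕ → ℕ) (p : ℕ → Bool) →
                  (∀ N → f N ≤ f (suc N)) → (∀ N → f (suc N) ≤ suc (f N)) →
                  (∀ N → p (suc N) ≡ does (+ f N ℤ.<? + f (suc N))) →
                  ∀ N → countUpTo p N ℕ.+ f 0 ≡ f N
countUpTo-jumps f p mono unit p≡jump zero = refl
countUpTo-jumps f p mono unit p≡jump (suc N) = begin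
  (c ℕ.+ b) ℕ.+ f 0   ≡⟨ cong (ℕ._+ f 0) (ℕP.+-comm c b) ⟩
  (b ℕ.+ c) ℕ.+ f 0   ≡⟨ ℕP.+-assoc b c (f 0) ⟩
  b ℕ.+ (c ℕ.+ f 0)   ≡⟨ cong (b ℕ.+_) (countUpTo-jumps f p mono unit p≡jump N) ⟩
  b ℕ.+ f N           ≡⟨ cong (λ t → (if t then 1 else 0) ℕ.+ f N) (p≡jump N) ⟩
  (if does (+ f N ℤ.<? + f (suc N)) then 1 else 0) ℕ.+ f N
                      ≡⟨ jump-indicator (mono N) (unit N) ⟩
  f (suc N)           ∎
  where
  open ≡-Reasoning
  c b : ℕ
  c = countUpTo p N
  b = if p (suc N) then 1 else 0

module RankOfMultiples (G : Graph) (P : Fin (size G)) (r : Divisor G → ℤ)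
                       (isRank : ∀ D → IsRank G D (r D)) where

  open LinearSystems G

  mP : ℕ → Divisor G
  mP m = scalePt G (+ m) P

  mP-+ : ∀ m n → mP (m ℕ.+ n) ≗ mP m ⊕ mP n
  mP-+ m n = scalePt-+ G (+ m) (+ n) P

  mP-suc : ∀ m → mP (suc m) ≗ mP m ⊕ pt P
  mP-suc m Q = trans (cong (λ k → mP k Q) (ℕP.+-comm 1 m)) (mP-+ m 1 Q)

  rank-mP : ∀ m → Σ ℕ λ k → r (mP m) ≡ + k × RankAtLeast G (mP m) k ×
                           (∀ j → RankAtLeast G (mP m) j → j ≤ k)
  rank-mP m with r (mP m) | isRank (mP m)
  ... | -[1+ zero ] | ¬linSys =
    ⊥-elim (¬linSys (effective⇒linSys (scalePt-nonneg G P (+≤+ z≤n))))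
  ... | + k | _ , rk , maximal = k , refl , rk , maximal

  ρ : ℕ → ℕ
  ρ m = proj₁ (rank-mP m)

  r≡ρ : ∀ m → r (mP m) ≡ + ρ m
  r≡ρ m = proj₁ (proj₂ (rank-mP m))

  rankAtLeast-ρ : ∀ m → RankAtLeast G (mP m) (ρ m)
  rankAtLeast-ρ m = proj₁ (proj₂ (proj₂ (rank-mP m)))

  ρ-maximal : ∀ m j → RankAtLeast G (mP m) j → j ≤ ρ m
  ρ-maximal m = proj₂ (proj₂ (proj₂ (rank-mP m)))

  ρ-mono : ∀ m → ρ m ≤ ρ (suc m)
  ρ-mono m = ρ-maximal (suc m) (ρ m)
    (rankAtLeast-resp (λ Q → sym (mP-suc m Q))
      (rankAtLeast-⊕-effective {mP m} (rankAtLeast-ρ m) (scalePt-nonneg G P (+≤+ z≤n))))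

  rankAtLeast-mP-suc⇒≤ : ∀ m j → RankAtLeast G (mP (suc m)) j → j ≤ suc (ρ m)
  rankAtLeast-mP-suc⇒≤ m zero    _  = z≤n
  rankAtLeast-mP-suc⇒≤ m (suc j) rk = s≤s (ρ-maximal m j
    (rankAtLeast-resp (λ Q → trans (cong (_- pt P Q) (mP-suc m Q)) (cancel (mP m Q) (pt P Q)))
      (rankAtLeast-suc⁻¹ {mP (suc m)} rk P)))
    where
    cancel : ∀ d q → (d + q) - q ≡ d
    cancel = solve-∀

  ρ-suc≤ : ∀ m → ρ (suc m) ≤ suc (ρ m)
  ρ-suc≤ m = rankAtLeast-mP-suc⇒≤ m (ρ (suc m)) (rankAtLeast-ρ (suc m))

  ρ-superadditive : ∀ m n → ρ m ℕ.+ ρ n ≤ ρ (m ℕ.+ n)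
  ρ-superadditive m n = ρ-maximal (m ℕ.+ n) _
    (rankAtLeast-resp (λ Q → sym (mP-+ m n Q))
      (rankAtLeast-⊕ (ρ m) {D = mP m} {mP n} (rankAtLeast-ρ m) (rankAtLeast-ρ n)))

  ρ-* : ∀ k n → k * ρ n ≤ ρ (k * n)
  ρ-* zero    n = z≤n
  ρ-* (suc k) n = ℕP.≤-trans (ℕP.+-monoʳ-≤ (ρ n) (ρ-* k n)) (ρ-superadditive n (k * n))

  -- inH compares r((m − 1)P) with r(mP); for m = suc N the index + suc N - + 1 computes to + N.
  countH+ρ₀≡ρ : ∀ N → countH G r P N ℕ.+ ρ 0 ≡ ρ N
  countH+ρ₀≡ρ = countUpTo-jumps ρ (inH G r P) ρ-mono ρ-suc≤
    (λ N → cong₂ (λ x y → does (x ℤ.<? y)) (r≡ρ N) (r≡ρ (suc N)))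

proposition5p7 : (G : Graph) (P : Fin (size G)) (r : Divisor G → ℤ)
    → (∀ D → IsRank G D (r D))
    → ∀ (n k : ℕ) → k * countH G r P n ≤ countH G r P (n * k)
proposition5p7 G P r isRank n zero    = z≤n
proposition5p7 G P r isRank n (suc k) = ℕP.+-cancelʳ-≤ (ρ 0) _ _ (begin
  suc k * c n ℕ.+ ρ 0          ≤⟨ ℕP.+-monoʳ-≤ (suc k * c n) (ℕP.m≤n*m (ρ 0) (suc k)) ⟩
  suc k * c n ℕ.+ suc k * ρ 0  ≡⟨ ℕP.*-distribˡ-+ (suc k) (c n) (ρ 0) ⟨
  suc k * (c n ℕ.+ ρ 0)        ≡⟨ cong (suc k *_) (countH+ρ₀≡ρ n) ⟩
  suc k * ρ n                  ≤⟨ ρ-* (suc k) n ⟩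
  ρ (suc k * n)                ≡⟨ cong ρ (ℕP.*-comm (suc k) n) ⟩
  ρ (n * suc k)                ≡⟨ countH+ρ₀≡ρ (n * suc k) ⟨
  c (n * suc k) ℕ.+ ρ 0        ∎)
  where
  open RankOfMultiples G P r isRank
  open ℕP.≤-Reasoning
  c : ℕ → ℕ
  c = countH G r P
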